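{- Let $t\ge 2$, $A=\{0,1,\ldots,t-1\}$, let $s>1$ and $n\ge s$ be integers, and let $P$ be a preference function of span $s-1$ whose induced least preference function $g$ satisfies $g(0^{s-1})=0^{s-1}$ and has no cycles other than this self-loop (for every $x\in A^{s-1}\setminus\{0^{s-1}\}$ there is no $k\ge1$ with $g^k(x)=x$). Let $S$ be the sequence produced by Algorithm P with inputs $s,n,P$. Then for every $b\in A$, the word $b0^{n-1}$ occurs in $S$ as a block of contiguous symbols.
   Context: A preference function $P$ of span $s-1$ assigns to each $\mathbf a\in A^{s-1}$ a vector $(P_1(\mathbf a),\ldots,P_t(\mathbf a))$ whose entries form a permutation of $A$. Its least preference function is $g(a_1,\ldots,a_{s-1})=(a_2,\ldots,a_{s-1},P_t(a_1,\ldots,a_{s-1}))$. $0^m$ denotes the word of $m$ zeros. Algorithm P produces a finite sequence $(a_i)$: $a_1=\cdots=a_n=0$; if $a_{N+1},\ldots,a_{N+n-1}$ have been defined (starting with $N=1$), set $a_{N+n}=P_i(a_{N+n-s+1},\ldots,a_{N+n-1})$ where $i\in\{1,\ldots,t\}$ is the smallest index such that the word $(a_{N+1},\ldots,a_{N+n-1},P_i(a_{N+n-s+1},\ldots,a_{N+n-1}))$ has not previously appeared as a block of contiguous symbols of the sequence; if no such $i$ exists, the sequence ends at $a_{N+n-1}$. -}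

module Defs where

open import Data.Nat using (ℕ; zero; suc; _∸_)
open import Data.Fin using (Fin; zero; suc; _≟_)
import Data.Fin as Fin
open import Data.List using (List; []; _∷_; _++_; [_]; length; drop; replicate; reverse; allFin; _∷ʳ_)
open import Data.Vec as Vec using (Vec)
open import Data.Maybe using (Maybe; just; nothing)
open import Data.Product using (_×_)
open import Relation.Nullary using (yes; no)
open import Relation.Binary.PropositionalEquality using (_≡_)
open import Function.Definitions using (Bijective)
open import Data.List.Relation.Binary.Infix.Heterogeneous using (Infix)
open import Data.List.Relation.Binary.Infix.Heterogeneous.Properties using (infix?)

-- The alphabet A = {0,...,t-1} with t = suc k.
Alph : ℕ → Set
Alph k = Fin (suc k)

Block : ∀ {k} → List (Alph k) → List (Alph k) → Set
Block u S = Infix _≡_ u S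

-- A preference function of span m (= s - 1) over the alphabet Fin (suc k):
-- to each a ∈ A^m it assigns (P_1(a),...,P_t(a)), a permutation of A;
-- index i ∈ {1..t} is represented by Fin (suc k) (index 1 = zero, index t = last).
record PreferenceFunction (k m : ℕ) : Set where
  field
    pref : Vec (Alph k) m → Fin (suc k) → Alph k
    isPerm : ∀ a → Bijective _≡_ _≡_ (pref a)

leastPref : ∀ {k m} → PreferenceFunction k m → Vec (Alph k) m → Vec (Alph k) m
leastPref {k} P a = Vec.tail (a Vec.∷ʳ PreferenceFunction.pref P a (Fin.fromℕ k))

iter : ∀ {X : Set} → ℕ → (X → X) → X → X
iter zero f x = x
iter (suc j) f x = f (iter j f x)

zeros : ∀ {k} m → Vec (Alph k) m
zeros m = Vec.replicate m zero

-- Padded with zeros on the left if the list is too short; this never happens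
-- in Algorithm P since the sequence always has length ≥ n ≥ s > m.
lastVec : ∀ {k} m → List (Alph k) → Vec (Alph k) m
lastVec m xs = Vec.reverse (go m (reverse xs))
  where
  go : ∀ j → List _ → Vec _ j
  go zero _ = Vec.[]
  go (suc j) [] = zero Vec.∷ go j []
  go (suc j) (x ∷ ys) = x Vec.∷ go j ys

lastList : ∀ {k} → ℕ → List (Alph k) → List (Alph k)
lastList j xs = drop (length xs ∸ j) xs

module AlgorithmP {k m : ℕ} (n : ℕ) (P : PreferenceFunction k m) where
  open PreferenceFunction P

  firstNew : List (Alph k) → List (Fin (suc k)) → Maybe (Alph k)
  firstNew S [] = nothing
  firstNew S (i ∷ is) with infix? _≟_ (lastList (n ∸ 1) S ∷ʳ pref (lastVec m S) i) S
  ... | yes _ = firstNew S is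
  ... | no _ = just (pref (lastVec m S) i)

  -- One step of Algorithm P: nothing means the sequence ends here.
  step : List (Alph k) → Maybe (List (Alph k))
  step S with firstNew S (allFin (suc k))
  ... | nothing = nothing
  ... | just x = just (S ∷ʳ x)

  data Reach : List (Alph k) → Set where
    start : Reach (replicate n zero)
    next  : ∀ {S S'} → Reach S → step S ≡ just S' → Reach S'

  Produces : List (Alph k) → Set
  Produces S = Reach S × (step S ≡ nothing)

module Submission where

-- Write n = 1 + j and let w be the last j symbols of the final
-- sequence S.  Two invariants hold along the run: S starts with 0^n, and
-- every word of length n occurs at most once in S (a new symbol is only
-- appended when the resulting final n-block is new).  When the algorithm
-- stops, each of the t extensions w P_i(v) already occurs in S; together
-- with the final occurrence of w this gives t + 1 occurrences of w, at
-- pairwise distinct offsets (what follows them differs).  Label each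
-- occurrence by its preceding symbol, or by b if it starts S.  With only t
-- labels, two occurrences share a label (pigeonhole).  They cannot both have
-- a real predecessor c, since c w would then occur twice; so one of them
-- starts S, forcing w = 0^j, and the other is preceded by b: b 0^j occurs.

open import Defs
open import Data.Nat using (ℕ; suc; _≤_; _∸_)
open import Data.Fin using (zero)
open import Data.List using (_∷_; replicate)
open import Data.Vec using (Vec)
open import Relation.Binary.PropositionalEquality using (_≡_; _≢_)

open import Data.Nat using (zero; _+_; s≤s)
open import Data.Nat.Properties
  using (suc-injective; 0≢1+n; n<1+n; <-irrefl; n≤1+n; ≤-trans; m+n∸n≡m; m∸[m∸n]≡n)
open import Data.Fin as Fin using (Fin; _≟_)
open import Data.Fin.Properties using (pigeonhole; <⇒≢)
open import Data.List using (List; []; _++_; [_]; length; drop; take; _∷ʳ_; allFin; initLast; _∷ʳ′_)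
open import Data.List.Properties
  using (++-assoc; ++-identityʳ; ++-cancelˡ; ++-cancelʳ; length-++; length-++-sucʳ; length-drop;
         length-replicate; take++drop≡id; ∷-injective; ∷-injectiveˡ; ∷-injectiveʳ;
         ∷ʳ-injective; ∷ʳ-injectiveˡ)
open import Data.List.Relation.Binary.Infix.Heterogeneous as Infix using (Infix)
open import Data.List.Relation.Binary.Infix.Heterogeneous.Properties using (infix?; length-mono)
open import Data.List.Relation.Binary.Pointwise using (Pointwise-≡⇒≡; ≡⇒Pointwise-≡)
open import Data.List.Relation.Unary.Any using (here; there)
open import Data.List.Membership.Propositional using (_∈_)
open import Data.List.Membership.Propositional.Properties using (∈-allFin)
open import Data.Maybe using (just; nothing)
open import Data.Product using (Σ-syntax; _×_; _,_; proj₁; proj₂)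
open import Data.Sum using (_⊎_; inj₁; inj₂)
open import Data.Empty using (⊥-elim)
open import Function using (_∘_)
open import Relation.Nullary using (¬_; yes; no)
open import Relation.Binary.PropositionalEquality
  using (refl; sym; trans; cong; subst; module ≡-Reasoning)

module Words {A : Set} where

  record Occurrence (u S : List A) : Set where
    constructor occurrenceAt
    field
      before after : List A
      split        : S ≡ before ++ u ++ after

  open Occurrence public

  offset : ∀ {u S} → Occurrence u S → ℕ
  offset o = length (before o)

  occurrence : ∀ {u S} → Infix _≡_ u S → Occurrence u S
  occurrence i with Infix.MkView pre eq post ← Infix.toView i =
    occurrenceAt pre post (cong (λ v → pre ++ v ++ post) (sym (Pointwise-≡⇒≡ eq)))

  block : ∀ {u S} → Occurrence u S → Infix _≡_ u S
  block (occurrenceAt pre post refl) = Infix.fromView (Infix.MkView pre (≡⇒Pointwise-≡ refl) post)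

  UniqueBlocks : ℕ → List A → Set
  UniqueBlocks n S = ∀ {B} → length B ≡ n → (o o' : Occurrence B S) → offset o ≡ offset o'

  offset-full : ∀ {B S} → length B ≡ length S → (o : Occurrence B S) → offset o ≡ 0
  offset-full eq (occurrenceAt []      _    _)    = refl
  offset-full eq (occurrenceAt (c ∷ pre) post refl) =
    ⊥-elim (<-irrefl eq (s≤s (length-mono (block (occurrenceAt pre post refl)))))

  unique-full : ∀ S → UniqueBlocks (length S) S
  unique-full S lB o o' = trans (offset-full lB o) (sym (offset-full lB o'))

  occurrence-∷ʳ : ∀ S x {B} → B ≢ [] → (o : Occurrence B (S ∷ʳ x)) →
    (Σ[ o' ∈ Occurrence B S ] offset o' ≡ offset o) ⊎
    (Σ[ B' ∈ List A ] B ≡ B' ∷ʳ x × S ≡ before o ++ B')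
  occurrence-∷ʳ S x {B} B≢[] (occurrenceAt pre post eq) with initLast post
  ... | post' ∷ʳ′ y = inj₁ (occurrenceAt pre post' (∷ʳ-injectiveˡ S _ reassociated) , refl)
    where
    open ≡-Reasoning
    reassociated : S ∷ʳ x ≡ (pre ++ B ++ post') ∷ʳ y
    reassociated = begin
      S ∷ʳ x                       ≡⟨ eq ⟩
      pre ++ B ++ (post' ++ [ y ]) ≡⟨ cong (pre ++_) (sym (++-assoc B post' [ y ])) ⟩
      pre ++ (B ++ post') ++ [ y ] ≡⟨ sym (++-assoc pre (B ++ post') [ y ]) ⟩
      (pre ++ B ++ post') ∷ʳ y     ∎
  ... | [] with initLast B
  ...   | [] = ⊥-elim (B≢[] refl)
  ...   | B' ∷ʳ′ y
    with refl , refl ← ∷ʳ-injective S (pre ++ B')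
           (trans eq (trans (cong (pre ++_) (++-identityʳ (B' ∷ʳ y))) (sym (++-assoc pre B' [ y ]))))
    = inj₂ (B' , refl , refl)

  length-∷ʳ : ∀ (xs : List A) x → length (xs ∷ʳ x) ≡ suc (length xs)
  length-∷ʳ xs x = trans (length-++-sucʳ xs x []) (cong (suc ∘ length) (++-identityʳ xs))

  drop-length-++ : ∀ (xs ys : List A) → drop (length xs) (xs ++ ys) ≡ ys
  drop-length-++ []       ys = refl
  drop-length-++ (x ∷ xs) ys = drop-length-++ xs ys

  length-init : ∀ {j} (B' : List A) x → length (B' ∷ʳ x) ≡ suc j → length B' ≡ j
  length-init B' x l = suc-injective (trans (sym (length-∷ʳ B' x)) l)

  occurrence-init : ∀ {u S} {c : A} → Occurrence (u ∷ʳ c) S → Occurrence u S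
  occurrence-init {u} {c = c} (occurrenceAt pre post eq) =
    occurrenceAt pre (c ∷ post) (trans eq (cong (pre ++_) (++-assoc u [ c ] post)))

  occurrence-cons : ∀ {u S pre} {c : A} (o : Occurrence u S) → before o ≡ pre ∷ʳ c →
                    Σ[ o' ∈ Occurrence (c ∷ u) S ] offset o ≡ suc (offset o')
  occurrence-cons {u} {pre = pre} {c} (occurrenceAt _ post eq) refl =
    occurrenceAt pre post (trans eq (++-assoc pre [ c ] (u ++ post))) , length-∷ʳ pre c

  after-unique : ∀ {u S} (o o' : Occurrence u S) → offset o ≡ offset o' → after o ≡ after o'
  after-unique {u} (occurrenceAt pre post eq) (occurrenceAt pre' post' eq') same =
    ++-cancelˡ u post post' (cancel-equal-length pre pre' same (trans (sym eq) eq'))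
    where
    cancel-equal-length : ∀ (xs ys : List A) {r r'} → length xs ≡ length ys → xs ++ r ≡ ys ++ r' → r ≡ r'
    cancel-equal-length []       []       _ e = e
    cancel-equal-length (x ∷ xs) (y ∷ ys) l e = cancel-equal-length xs ys (suc-injective l) (∷-injectiveʳ e)

  prefix-of-replicate : ∀ (z : A) n (w r q : List A) → length w ≤ n →
                        w ++ r ≡ replicate n z ++ q → w ≡ replicate (length w) z
  prefix-of-replicate z n       []      r q _       e = refl
  prefix-of-replicate z (suc n) (x ∷ w) r q (s≤s l) e with refl , e' ← ∷-injective e =
    cong (z ∷_) (prefix-of-replicate z n w r q l e')

  lastOr : A → List A → A
  lastOr d []       = d
  lastOr d (x ∷ xs) = lastOr x xs

  lastOr-view : ∀ d (xs : List A) → xs ≡ [] ⊎ Σ[ u ∈ List A ] xs ≡ u ∷ʳ lastOr d xs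
  lastOr-view d []       = inj₁ refl
  lastOr-view d (x ∷ xs) with lastOr-view x xs
  ... | inj₁ refl     = inj₂ ([] , refl)
  ... | inj₂ (u , eq) = inj₂ (x ∷ u , cong (x ∷_) eq)

open Words

module FinalBlocks {k : ℕ} where

  private
    A : Set
    A = Alph k

  lastList-++ : ∀ {j} (pre B : List A) → length B ≡ j → lastList j (pre ++ B) ≡ B
  lastList-++ {j} pre B refl = begin
    drop (length (pre ++ B) ∸ j) (pre ++ B)    ≡⟨ cong (λ ℓ → drop (ℓ ∸ j) (pre ++ B)) (length-++ pre) ⟩
    drop (length pre + j ∸ j) (pre ++ B)       ≡⟨ cong (λ ℓ → drop ℓ (pre ++ B)) (m+n∸n≡m (length pre) j) ⟩
    drop (length pre) (pre ++ B)               ≡⟨ drop-length-++ pre B ⟩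
    B                                          ∎
    where open ≡-Reasoning

  final-occurrence : ∀ j (S : List A) → Occurrence (lastList j S) S
  final-occurrence j S = occurrenceAt (take (length S ∸ j) S) []
    (sym (trans (cong (take (length S ∸ j) S ++_) (++-identityʳ (lastList j S)))
                (take++drop≡id (length S ∸ j) S)))

  length-lastList : ∀ j (S : List A) → j ≤ length S → length (lastList j S) ≡ j
  length-lastList j S j≤ = trans (length-drop (length S ∸ j) S) (m∸[m∸n]≡n j≤)

  final-block : ∀ {j} S pre B' (x : A) → S ≡ pre ++ B' → length (B' ∷ʳ x) ≡ suc j →
                Occurrence (B' ∷ʳ x) S → Infix _≡_ (lastList j S ∷ʳ x) S
  final-block S pre B' x refl l p =
    subst (λ u → Infix _≡_ (u ∷ʳ x) S) (sym (lastList-++ pre B' (length-init B' x l))) (block p)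

  unique-∷ʳ : ∀ {j} S x → ¬ Infix _≡_ (lastList j S ∷ʳ x) S →
              UniqueBlocks (suc j) S → UniqueBlocks (suc j) (S ∷ʳ x)
  unique-∷ʳ {j} S x new unique {B} lB o o'
    with occurrence-∷ʳ S x nonempty o | occurrence-∷ʳ S x nonempty o'
    where
    nonempty : B ≢ []
    nonempty refl = 0≢1+n lB
  ... | inj₁ (p , p≡) | inj₁ (p' , p'≡) = trans (sym p≡) (trans (unique lB p p') p'≡)
  ... | inj₂ (B₁ , refl , S≡) | inj₂ (B₂ , B≡ , S≡') with refl ← ∷ʳ-injectiveˡ B₁ B₂ B≡ =
    cong length (++-cancelʳ B₁ (before o) (before o') (trans (sym S≡) S≡'))
  ... | inj₂ (B₁ , refl , S≡) | inj₁ (p' , _) = ⊥-elim (new (final-block S (before o) B₁ x S≡ lB p'))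
  ... | inj₁ (p , _) | inj₂ (B₂ , refl , S≡') = ⊥-elim (new (final-block S (before o') B₂ x S≡' lB p))

open FinalBlocks

module Steps {k m : ℕ} (j : ℕ) (P : PreferenceFunction k m) where
  open AlgorithmP (suc j) P
  open PreferenceFunction P

  firstNew-just : ∀ S is x → firstNew S is ≡ just x → ¬ Infix _≡_ (lastList j S ∷ʳ x) S
  firstNew-just S (i ∷ is) x eq with infix? _≟_ (lastList j S ∷ʳ pref (lastVec m S) i) S
  ... | yes _ = firstNew-just S is x eq
  ... | no new with refl ← eq = new

  firstNew-nothing : ∀ S is → firstNew S is ≡ nothing →
                     ∀ {i} → i ∈ is → Infix _≡_ (lastList j S ∷ʳ pref (lastVec m S) i) S
  firstNew-nothing S (i ∷ is) eq i∈ with infix? _≟_ (lastList j S ∷ʳ pref (lastVec m S) i) S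
  firstNew-nothing S (i ∷ is) () i∈         | no _
  firstNew-nothing S (i ∷ is) eq (here refl) | yes old = old
  firstNew-nothing S (i ∷ is) eq (there i∈)  | yes _   = firstNew-nothing S is eq i∈

  step-just : ∀ {S S'} → step S ≡ just S' →
              Σ[ x ∈ Alph k ] S' ≡ S ∷ʳ x × ¬ Infix _≡_ (lastList j S ∷ʳ x) S
  step-just {S} eq with firstNew S (allFin (suc k)) in found
  step-just {S} () | nothing
  step-just {S} refl | just x = x , refl , firstNew-just S (allFin (suc k)) x found

  step-nothing : ∀ {S} → step S ≡ nothing → ∀ i → Infix _≡_ (lastList j S ∷ʳ pref (lastVec m S) i) S
  step-nothing {S} eq i with firstNew S (allFin (suc k)) in found
  step-nothing eq i  | nothing = firstNew-nothing _ (allFin (suc k)) found (∈-allFin i)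
  step-nothing () i  | just x

module Invariant {k m : ℕ} (j : ℕ) (P : PreferenceFunction k m) where
  open AlgorithmP (suc j) P
  open Steps j P

  zeroWord : List (Alph k)
  zeroWord = replicate (suc j) zero

  StartsWithZeros : List (Alph k) → Set
  StartsWithZeros S = Σ[ r ∈ List (Alph k) ] S ≡ zeroWord ++ r

  invariant : ∀ {S} → Reach S → UniqueBlocks (suc j) S × StartsWithZeros S
  invariant start =
    subst (λ ℓ → UniqueBlocks ℓ zeroWord) (length-replicate (suc j)) (unique-full zeroWord) ,
    [] , sym (++-identityʳ _)
  invariant (next R eq) with step-just eq | invariant R
  ... | x , refl , new | unique , r , refl =
    unique-∷ʳ _ x new unique , r ∷ʳ x , ++-assoc zeroWord r [ x ]

module Termination {k m : ℕ} (j : ℕ) (P : PreferenceFunction k m) {S : List (Alph k)}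
                   (run : AlgorithmP.Reach (suc j) P S)
                   (stop : AlgorithmP.step (suc j) P S ≡ nothing) where
  open PreferenceFunction P
  open Steps j P
  open Invariant j P

  unique : UniqueBlocks (suc j) S
  unique = proj₁ (invariant run)

  startsWithZeros : StartsWithZeros S
  startsWithZeros = proj₂ (invariant run)

  w : List (Alph k)
  w = lastList j S

  n≤length-S : suc j ≤ length S
  n≤length-S with r , eq ← startsWithZeros =
    subst (_≤ length S) (length-replicate (suc j)) (length-mono (block (occurrenceAt [] r eq)))

  length-w : length w ≡ j
  length-w = length-lastList j S (≤-trans (n≤1+n j) n≤length-S)

  -- The t + 1 occurrences of w: the final one (zero) and, for each
  -- preference index i, the one followed by P_i(v) (suc i).
  occurrenceOf : Fin (suc (suc k)) → Occurrence w S
  occurrenceOf zero        = final-occurrence j S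
  occurrenceOf (Fin.suc i) = occurrence-init (occurrence (step-nothing stop i))

  -- They sit at distinct offsets: what follows them differs, since
  -- P_i(v) is injective in i.
  occurrenceOf-injective : ∀ o o' → offset (occurrenceOf o) ≡ offset (occurrenceOf o') → o ≡ o'
  occurrenceOf-injective o o' same = followedAlike o o' (after-unique (occurrenceOf o) (occurrenceOf o') same)
    where
    followedAlike : ∀ o o' → after (occurrenceOf o) ≡ after (occurrenceOf o') → o ≡ o'
    followedAlike zero        zero         _      = refl
    followedAlike zero        (Fin.suc _)  ()
    followedAlike (Fin.suc _) zero         ()
    followedAlike (Fin.suc i) (Fin.suc i') afters =
      cong Fin.suc (proj₁ (isPerm (lastVec m S)) (∷-injectiveˡ afters))

  w-zeros : (o : Occurrence w S) → before o ≡ [] → w ≡ replicate j zero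
  w-zeros o atStart with r , eq ← startsWithZeros =
    trans (prefix-of-replicate zero (suc j) w (after o) r (subst (_≤ suc j) (sym length-w) (n≤1+n j)) w++after≡)
          (cong (λ ℓ → replicate ℓ zero) length-w)
    where
    w++after≡ : w ++ after o ≡ zeroWord ++ r
    w++after≡ = trans (sym (trans (split o) (cong (_++ w ++ after o) atStart))) eq

  fromStart : (b : Alph k) (o o' : Occurrence w S) {pre : List (Alph k)} →
              before o ≡ [] → before o' ≡ pre ∷ʳ b → Block (b ∷ replicate j zero) S
  fromStart b o o' atStart preceded with p , _ ← occurrence-cons o' preceded =
    subst (λ u → Block (b ∷ u) S) (w-zeros o atStart) (block p)

  -- Label an occurrence by its preceding symbol, or by b at the start.
  -- Two occurrences at distinct offsets with the same label give b 0^j: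
  -- both preceded by c is impossible, as c w would occur twice.
  collision : (b : Alph k) (o o' : Occurrence w S) → offset o ≢ offset o' →
              lastOr b (before o) ≡ lastOr b (before o') → Block (b ∷ replicate j zero) S
  collision b o o' distinct sameLabel with lastOr-view b (before o) | lastOr-view b (before o')
  ... | inj₁ atStart | inj₁ atStart' =
    ⊥-elim (distinct (trans (cong length atStart) (sym (cong length atStart'))))
  ... | inj₁ atStart | inj₂ (_ , preceded') =
    fromStart b o o' atStart (trans preceded' (cong (_ ∷ʳ_) (trans (sym sameLabel) (cong (lastOr b) atStart))))
  ... | inj₂ (_ , preceded) | inj₁ atStart' =
    fromStart b o' o atStart' (trans preceded (cong (_ ∷ʳ_) (trans sameLabel (cong (lastOr b) atStart'))))
  ... | inj₂ (_ , preceded) | inj₂ (_ , preceded')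
    with p , o≡ ← occurrence-cons o preceded
       | p' , o'≡ ← occurrence-cons o' (trans preceded' (cong (_ ∷ʳ_) (sym sameLabel))) =
    ⊥-elim (distinct (trans o≡ (trans (cong suc (unique (cong suc length-w) p p')) (sym o'≡))))

  -- Pigeonhole: t + 1 occurrences of w, only t labels.
  occurs : (b : Alph k) → Block (b ∷ replicate j zero) S
  occurs b with pigeonhole (n<1+n (suc k)) label
    where
    label : Fin (suc (suc k)) → Alph k
    label o = lastOr b (before (occurrenceOf o))
  ... | o , o' , o<o' , sameLabel =
    collision b (occurrenceOf o) (occurrenceOf o') (<⇒≢ o<o' ∘ occurrenceOf-injective o o') sameLabel

mainTheorem5 : (k m n : ℕ) → 1 ≤ k → 1 ≤ m → suc m ≤ n →
    (P : PreferenceFunction k m) →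
    leastPref P (zeros m) ≡ zeros m →
    (∀ (x : Vec (Alph k) m) → x ≢ zeros m → ∀ j → 1 ≤ j → iter j (leastPref P) x ≢ x) →
    ∀ S → AlgorithmP.Produces n P S →
    ∀ (b : Alph k) → Block (b ∷ replicate (n ∸ 1) zero) S
mainTheorem5 k m zero    _ _ ()  P _ _ S _ b
mainTheorem5 k m (suc j) _ _ _  P _ _ S (run , stop) b = Termination.occurs j P run stop b
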